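{- Let $\Sigma$ be an implicational base over a finite set $U$ with closure system $\mathcal{C}$, and let $(U_1,U_2)$ be an acyclic split of $\Sigma$. Let $C_2,C_2'\in\mathcal{C}_2$ with $C_2\subseteq C_2'$. Then $\mathrm{Ext}(C_2):U_1\subseteq\mathrm{Ext}(C_2'):U_1$.
   Context: An implication over $U$ is written $A \to b$ with $A \subseteq U$ nonempty and $b \in U$; an implicational base is a finite set of implications. $C\subseteq U$ satisfies $\Sigma$ if for all $A\to b\in\Sigma$, $A\subseteq C$ implies $b\in C$; the closure system of $\Sigma$ is the family of subsets satisfying $\Sigma$. For $X\subseteq U$, $\Sigma[X]=\{A\to b\in\Sigma: A\cup\{b\}\subseteq X\}$. A split of $\Sigma$ is a bipartition $(U_1,U_2)$ of $U$ into nonempty disjoint sets such that every premise is contained in $U_1$ or in $U_2$; $\Sigma[U_1,U_2]:=\Sigma\setminus(\Sigma[U_1]\cup\Sigma[U_2])$. The split is acyclic if $A\subseteq U_1$ for every $A\to b\in\Sigma[U_1,U_2]$. $\mathcal{C}_2$ is the closure system of $\Sigma[U_2]$ over $U_2$. For $C_2\subseteq U_2$, $\mathrm{Ext}(C_2)=\{C\in\mathcal{C}: C\cap U_2=C_2\}$ (the extensions of $C_2$), and $\mathrm{Ext}(C_2):U_1=\{C\cap U_1: C\in\mathrm{Ext}(C_2)\}$. -}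

module Defs where

open import Data.Nat using (ℕ)
open import Data.Fin using (Fin)
open import Data.Fin.Subset using (Subset; _⊆_; _∈_; _∉_; ∁; _∩_; _∪_; ⁅_⁆; Nonempty)
open import Data.List using (List)
open import Data.List.Membership.Propositional renaming (_∈_ to _∈ₗ_)
open import Data.Product using (Σ; _×_; ∃; ∃-syntax; _,_)
open import Data.Sum using (_⊎_)
open import Relation.Nullary using (¬_)
open import Relation.Binary.PropositionalEquality using (_≡_)

record Implication (n : ℕ) : Set where
  constructor _⇒_∣_
  field
    premise    : Subset n
    conclusion : Fin n
    nonempty   : Nonempty premise
open Implication public

ImplBase : ℕ → Set
ImplBase n = List (Implication n)

SatisfiesP : ∀ {n} → (Implication n → Set) → Subset n → Set
SatisfiesP {n} S C = ∀ (imp : Implication n) → S imp →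
  premise imp ⊆ C → conclusion imp ∈ C

Satisfies : ∀ {n} → ImplBase n → Subset n → Set
Satisfies Σ' C = SatisfiesP (_∈ₗ Σ') C

InRestr : ∀ {n} → ImplBase n → Subset n → Implication n → Set
InRestr Σ' X imp = imp ∈ₗ Σ' × (premise imp ∪ ⁅ conclusion imp ⁆) ⊆ X

InCross : ∀ {n} → ImplBase n → Subset n → Subset n → Implication n → Set
InCross Σ' U₁ U₂ imp =
  imp ∈ₗ Σ' × ¬ ((premise imp ∪ ⁅ conclusion imp ⁆) ⊆ U₁)
            × ¬ ((premise imp ∪ ⁅ conclusion imp ⁆) ⊆ U₂)

-- (U₁, U₂) with U₂ = ∁ U₁ is a split of Σ.
IsSplit : ∀ {n} → ImplBase n → Subset n → Set
IsSplit Σ' U₁ =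
  Nonempty U₁ × Nonempty (∁ U₁) ×
  (∀ imp → imp ∈ₗ Σ' → premise imp ⊆ U₁ ⊎ premise imp ⊆ ∁ U₁)

IsAcyclicSplit : ∀ {n} → ImplBase n → Subset n → Set
IsAcyclicSplit Σ' U₁ =
  IsSplit Σ' U₁ × (∀ imp → InCross Σ' U₁ (∁ U₁) imp → premise imp ⊆ U₁)

InC₂ : ∀ {n} → ImplBase n → Subset n → Subset n → Set
InC₂ Σ' U₂ C₂ = C₂ ⊆ U₂ × SatisfiesP (InRestr Σ' U₂) C₂

InExt : ∀ {n} → ImplBase n → Subset n → Subset n → Subset n → Set
InExt Σ' U₂ C₂ C = Satisfies Σ' C × C ∩ U₂ ≡ C₂

InExtRestr : ∀ {n} → ImplBase n → Subset n → Subset n → Subset n → Subset n → Set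
InExtRestr Σ' U₁ U₂ C₂ D = ∃[ C ] (InExt Σ' U₂ C₂ C × C ∩ U₁ ≡ D)

-- Given C ∈ Ext(C₂), glue C ∩ U₁ to C₂': the set C' = (C ∩ U₁) ∪ C₂' has trace C ∩ U₁ on U₁,
-- trace C₂' on U₂, and it is closed: an implication with premise in U₁ fires in C, and its conclusion lands in
-- C ∩ U₁ or in C ∩ U₂ = C₂ ⊆ C₂'; by acyclicity an implication with premise in U₂ also
-- concludes in U₂, so it belongs to Σ[U₂] and fires in C₂'.
module Submission where

open import Defs
open import Data.Nat using (ℕ)
open import Data.Fin using (Fin)
open import Data.Fin.Subset using (Subset; _⊆_; ∁; _∩_; _∪_; _∈_; _∉_; ⁅_⁆; ⊥)
open import Data.Fin.Subset.Properties
open import Data.List.Membership.Propositional using () renaming (_∈_ to _∈ₗ_)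
open import Data.Product using (_,_)
open import Data.Sum using (inj₁; inj₂)
open import Relation.Nullary using (¬_; yes; no)
open import Relation.Binary.PropositionalEquality
  using (_≡_; sym; trans; cong; cong₂; subst; module ≡-Reasoning)

private
  variable
    n : ℕ
    p p′ q r : Subset n
    x : Fin n

⊆-∩ : r ⊆ p → r ⊆ q → r ⊆ p ∩ q
⊆-∩ r⊆p r⊆q x∈r = x∈p∩q⁺ (r⊆p x∈r , r⊆q x∈r)

∪⁅⁆-⊆ : p ⊆ r → x ∈ r → p ∪ ⁅ x ⁆ ⊆ r
∪⁅⁆-⊆ {p = p} {x = x} p⊆r x∈r y∈p∪⁅x⁆ with x∈p∪q⁻ p ⁅ x ⁆ y∈p∪⁅x⁆
... | inj₁ y∈p   = p⊆r y∈p
... | inj₂ y∈⁅x⁆ = subst (_∈ _) (sym (x∈⁅y⁆⇒x≡y x y∈⁅x⁆)) x∈r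

p⊆q⇒p∩q≡p : p ⊆ q → p ∩ q ≡ p
p⊆q⇒p∩q≡p {p = p} {q = q} p⊆q = ⊆-antisym (p∩q⊆p p q) (⊆-∩ ⊆-refl p⊆q)

p⊆∁q⇒p∩q≡⊥ : p ⊆ ∁ q → p ∩ q ≡ ⊥
p⊆∁q⇒p∩q≡⊥ {p = p} {q = q} p⊆∁q = Empty-unique λ where
  (x , x∈p∩q) → let (x∈p , x∈q) = x∈p∩q⁻ p q x∈p∩q in x∈∁p⇒x∉p (p⊆∁q x∈p) x∈q

[p∩r]∪q∩r≡p∩r : q ⊆ ∁ r → ((p ∩ r) ∪ q) ∩ r ≡ p ∩ r
[p∩r]∪q∩r≡p∩r {q = q} {r = r} {p = p} q⊆∁r = begin
  ((p ∩ r) ∪ q) ∩ r        ≡⟨ ∩-distribʳ-∪ r (p ∩ r) q ⟩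
  ((p ∩ r) ∩ r) ∪ (q ∩ r)  ≡⟨ cong₂ _∪_ (∩-assoc p r r) (p⊆∁q⇒p∩q≡⊥ q⊆∁r) ⟩
  (p ∩ (r ∩ r)) ∪ ⊥        ≡⟨ cong (λ s → (p ∩ s) ∪ ⊥) (∩-idem r) ⟩
  (p ∩ r) ∪ ⊥              ≡⟨ ∪-identityʳ (p ∩ r) ⟩
  p ∩ r                    ∎
  where open ≡-Reasoning

[p∩r]∪q∩∁r≡q : q ⊆ ∁ r → ((p ∩ r) ∪ q) ∩ ∁ r ≡ q
[p∩r]∪q∩∁r≡q {q = q} {r = r} {p = p} q⊆∁r = begin
  ((p ∩ r) ∪ q) ∩ ∁ r          ≡⟨ ∩-distribʳ-∪ (∁ r) (p ∩ r) q ⟩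
  ((p ∩ r) ∩ ∁ r) ∪ (q ∩ ∁ r)  ≡⟨ cong₂ _∪_ (∩-assoc p r (∁ r)) (p⊆q⇒p∩q≡p q⊆∁r) ⟩
  (p ∩ (r ∩ ∁ r)) ∪ q          ≡⟨ cong (λ s → (p ∩ s) ∪ q) (∩-inverseʳ r) ⟩
  (p ∩ ⊥) ∪ q                  ≡⟨ cong (_∪ q) (∩-zeroʳ p) ⟩
  ⊥ ∪ q                        ≡⟨ ∪-identityˡ q ⟩
  q                            ∎
  where open ≡-Reasoning

⊆-[p∩r]∪q⇒⊆p : q ⊆ ∁ r → p′ ⊆ (p ∩ r) ∪ q → p′ ⊆ r → p′ ⊆ p
⊆-[p∩r]∪q⇒⊆p {q = q} {r = r} {p = p} q⊆∁r p′⊆ p′⊆r =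
  ⊆-trans (⊆-trans (⊆-∩ p′⊆ p′⊆r) (⊆-reflexive ([p∩r]∪q∩r≡p∩r q⊆∁r))) (p∩q⊆p p r)

⊆-[p∩r]∪q⇒⊆q : q ⊆ ∁ r → p′ ⊆ (p ∩ r) ∪ q → p′ ⊆ ∁ r → p′ ⊆ q
⊆-[p∩r]∪q⇒⊆q q⊆∁r p′⊆ p′⊆∁r =
  ⊆-trans (⊆-∩ p′⊆ p′⊆∁r) (⊆-reflexive ([p∩r]∪q∩∁r≡q q⊆∁r))

module _ {Σ' : ImplBase n} {U₁ : Subset n} where

  acyclic-conclusion∈∁ : IsAcyclicSplit Σ' U₁ → ∀ {imp} → imp ∈ₗ Σ' →
                         premise imp ⊆ ∁ U₁ → conclusion imp ∈ ∁ U₁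
  acyclic-conclusion∈∁ (_ , acyclic) {imp@(A ⇒ b ∣ (a , a∈A))} imp∈Σ' A⊆∁U₁ =
    x∉p⇒x∈∁p λ b∈U₁ → a∉U₁ (acyclic imp (imp∈Σ' , A∪b⊈U₁ , A∪b⊈∁U₁ b∈U₁) a∈A)
    where
    a∉U₁ : a ∉ U₁
    a∉U₁ = x∈∁p⇒x∉p (A⊆∁U₁ a∈A)
    A∪b⊈U₁ : ¬ (A ∪ ⁅ b ⁆ ⊆ U₁)
    A∪b⊈U₁ A∪b⊆U₁ = a∉U₁ (A∪b⊆U₁ (p⊆p∪q ⁅ b ⁆ a∈A))
    A∪b⊈∁U₁ : b ∈ U₁ → ¬ (A ∪ ⁅ b ⁆ ⊆ ∁ U₁)
    A∪b⊈∁U₁ b∈U₁ A∪b⊆∁U₁ = x∈∁p⇒x∉p (A∪b⊆∁U₁ (q⊆p∪q A ⁅ b ⁆ (x∈⁅x⁆ b))) b∈U₁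

  glue-satisfies : IsAcyclicSplit Σ' U₁ → ∀ {C C₂'} → Satisfies Σ' C → C ∩ ∁ U₁ ⊆ C₂' →
                   InC₂ Σ' (∁ U₁) C₂' → Satisfies Σ' ((C ∩ U₁) ∪ C₂')
  glue-satisfies acyclic@((_ , _ , split) , _) {C} {C₂'} C-closed C∩U₂⊆C₂' (C₂'⊆U₂ , C₂'-closed)
                 imp imp∈Σ' A⊆C' with split imp imp∈Σ'
  ... | inj₂ A⊆U₂ = q⊆p∪q (C ∩ U₁) C₂' (C₂'-closed imp (imp∈Σ' , A∪b⊆U₂) A⊆C₂')
    where
    A∪b⊆U₂ : premise imp ∪ ⁅ conclusion imp ⁆ ⊆ ∁ U₁
    A∪b⊆U₂ = ∪⁅⁆-⊆ A⊆U₂ (acyclic-conclusion∈∁ acyclic imp∈Σ' A⊆U₂)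
    A⊆C₂' : premise imp ⊆ C₂'
    A⊆C₂' = ⊆-[p∩r]∪q⇒⊆q C₂'⊆U₂ A⊆C' A⊆U₂
  ... | inj₁ A⊆U₁ with C-closed imp imp∈Σ' (⊆-[p∩r]∪q⇒⊆p C₂'⊆U₂ A⊆C' A⊆U₁) | conclusion imp ∈? U₁
  ...   | b∈C | yes b∈U₁ = p⊆p∪q C₂' (x∈p∩q⁺ (b∈C , b∈U₁))
  ...   | b∈C | no  b∉U₁ = q⊆p∪q (C ∩ U₁) C₂' (C∩U₂⊆C₂' (x∈p∩q⁺ (b∈C , x∉p⇒x∈∁p b∉U₁)))

lemma1 : ∀ {n : ℕ} (Σ' : ImplBase n) (U₁ : Subset n) →
    IsAcyclicSplit Σ' U₁ →
    ∀ (C₂ C₂' : Subset n) → InC₂ Σ' (∁ U₁) C₂ → InC₂ Σ' (∁ U₁) C₂' → C₂ ⊆ C₂' →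
    ∀ (D : Subset n) → InExtRestr Σ' U₁ (∁ U₁) C₂ D → InExtRestr Σ' U₁ (∁ U₁) C₂' D
lemma1 Σ' U₁ acyclic C₂ C₂' _ C₂'∈𝒞₂@(C₂'⊆U₂ , _) C₂⊆C₂' D (C , (C-closed , C∩U₂≡C₂) , C∩U₁≡D) =
  (C ∩ U₁) ∪ C₂' ,
  (glue-satisfies acyclic C-closed C∩U₂⊆C₂' C₂'∈𝒞₂ , [p∩r]∪q∩∁r≡q C₂'⊆U₂) ,
  trans ([p∩r]∪q∩r≡p∩r C₂'⊆U₂) C∩U₁≡D
  where
  C∩U₂⊆C₂' : C ∩ ∁ U₁ ⊆ C₂'
  C∩U₂⊆C₂' = ⊆-trans (⊆-reflexive C∩U₂≡C₂) C₂⊆C₂'
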